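{- Let $\phi$ be an LTL formula in negation normal form and let $S$ be a set of literals. Then $S\models_w of(\phi)$ holds if and only if there exists an obligation $O\in olg(\phi)$ with $O\subseteq S$.
   Context: Let $AP$ be a finite set of atomic propositions. A literal is an atom $a\in AP$ or its negation $\neg a$. LTL formulas in negation normal form (NNF) are generated by $\phi ::= \mathit{tt}\mid \mathit{ff}\mid a\mid \neg a\mid \phi\wedge\phi\mid\phi\vee\phi\mid X\phi\mid \phi U\phi\mid \phi R\phi$. The obligation set $olg(\phi)$ is defined recursively: - $olg(\mathit{tt})=\{\emptyset\}$ and $olg(\mathit{ff})=\{\{\mathit{ff}\}\}$; - $olg(p)=\{\{p\}\}$ for a literal $p$; - $olg(X\psi)=olg(\psi)$; - $olg(\psi_1\vee\psi_2)=olg(\psi_1)\cup olg(\psi_2)$; - $olg(\psi_1\wedge\psi_2)=\{O_1\cup O_2\mid O_1\in olg(\psi_1),O_2\in olg(\psi_2)\}$; - $olg(\psi_1U\psi_2)=olg(\psi_1R\psi_2)=olg(\psi_2)$. The obligation formula $of(\phi)$ is defined recursively: - $of(\mathit{tt})=\mathit{tt}$, $of(\mathit{ff})=\mathit{ff}$; - $of(p)=p$ for a literal $p$; - $of(X\psi)=of(\psi)$; - $of(\phi_1U\phi_2)=of(\phi_1R\phi_2)=of(\phi_2)$; - $of(\phi_1\wedge\phi_2)=of(\phi_1)\wedge of(\phi_2)$; - $of(\phi_1\vee\phi_2)=of(\phi_1)\vee of(\phi_2)$. Weak satisfaction $S\models_w\alpha$, for a set $S$ of literals (not necessarily consistent)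 and a propositional formula $\alpha$ in NNF, is defined syntactically: - for a literal $\alpha$, $S\models_w\alpha$ iff $\alpha\in S$; - $S\models_w\mathit{tt}$ always holds; - $S\models_w\mathit{ff}$ never holds; - $S\models_w\alpha_1\wedge\alpha_2$ iff $S\models_w\alpha_1$ and $S\models_w\alpha_2$; - $S\models_w\alpha_1\vee\alpha_2$ iff $S\models_w\alpha_1$ or $S\models_w\alpha_2$. For example, $\{a,\neg a\}\models_w a\wedge\neg a$. -}

module Defs where

open import Data.List using (List; []; _∷_; _++_; concatMap; map)
open import Data.List.Membership.Propositional using (_∈_)
open import Data.Empty using (⊥)
open import Data.Unit using (⊤)
open import Data.Product using (_×_)
open import Data.Sum using (_⊎_)

data Literal (AP : Set) : Set where
  pos : AP → Literal AP
  neg : AP → Literal AP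

data LTL (AP : Set) : Set where
  tt ff : LTL AP
  lit   : Literal AP → LTL AP
  _∧_ _∨_ : LTL AP → LTL AP → LTL AP
  X     : LTL AP → LTL AP
  _U_ _R_ : LTL AP → LTL AP → LTL AP

data PForm (AP : Set) : Set where
  tt ff : PForm AP
  lit   : Literal AP → PForm AP
  _∧_ _∨_ : PForm AP → PForm AP → PForm AP

data OElem (AP : Set) : Set where
  lit : Literal AP → OElem AP
  ff  : OElem AP

-- An obligation is a finite set of elements, represented as a list.
Obligation : Set → Set
Obligation AP = List (OElem AP)

olg : {AP : Set} → LTL AP → List (Obligation AP)
olg tt = [] ∷ []
olg ff = (ff ∷ []) ∷ []
olg (lit p) = (lit p ∷ []) ∷ []
olg (X ψ) = olg ψ
olg (ψ₁ ∨ ψ₂) = olg ψ₁ ++ olg ψ₂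
olg (ψ₁ ∧ ψ₂) = concatMap (λ O₁ → map (λ O₂ → O₁ ++ O₂) (olg ψ₂)) (olg ψ₁)
olg (ψ₁ U ψ₂) = olg ψ₂
olg (ψ₁ R ψ₂) = olg ψ₂

of : {AP : Set} → LTL AP → PForm AP
of tt = tt
of ff = ff
of (lit p) = lit p
of (X ψ) = of ψ
of (ψ₁ U ψ₂) = of ψ₂
of (ψ₁ R ψ₂) = of ψ₂
of (ψ₁ ∧ ψ₂) = of ψ₁ ∧ of ψ₂
of (ψ₁ ∨ ψ₂) = of ψ₁ ∨ of ψ₂

-- A set of literals S (not necessarily consistent), as a predicate.
LitSet : Set → Set₁
LitSet AP = Literal AP → Set

_⊨w_ : {AP : Set} → LitSet AP → PForm AP → Set
S ⊨w tt = ⊤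
S ⊨w ff = ⊥
S ⊨w lit p = S p
S ⊨w (α₁ ∧ α₂) = (S ⊨w α₁) × (S ⊨w α₂)
S ⊨w (α₁ ∨ α₂) = (S ⊨w α₁) ⊎ (S ⊨w α₂)

-- Membership of an obligation element in a set of literals:
-- ff is not a literal, hence never a member of S.
_∈S_ : {AP : Set} → OElem AP → LitSet AP → Set
lit p ∈S S = S p
ff ∈S S = ⊥

_⊆S_ : {AP : Set} → Obligation AP → LitSet AP → Set
O ⊆S S = ∀ {e} → e ∈ O → e ∈S S

-- Both sides are compositional in the same way. "Some obligation of olg φ is
-- contained in S" turns ∨ into a disjunction, since olg takes the union, and ∧
-- into a conjunction, since olg takes all pairwise unions and a union lies in S
-- iff both parts do; on tt, ff and literals it agrees with ⊨w (ff ∉ S), and X, U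
-- and R are transparent to both sides.
module Submission where

open import Defs
open import Data.List using (List; []; _∷_; _++_; concatMap; map; cartesianProductWith)
open import Data.List.Membership.Propositional using (_∈_)
open import Data.List.Membership.Propositional.Properties
  using (∈-++⁺ˡ; ∈-++⁺ʳ; ∈-++⁻; ∈-cartesianProductWith⁺; ∈-cartesianProductWith⁻)
open import Data.List.Relation.Unary.Any using (here; there)
open import Data.Product using (∃; _×_; _,_)
open import Data.Product.Function.NonDependent.Propositional using (_×-⇔_)
open import Data.Sum using (_⊎_; inj₁; inj₂; [_,_])
open import Data.Sum.Function.Propositional using (_⊎-⇔_)
open import Data.Unit using (⊤)
open import Function.Bundles using (_⇔_; mk⇔; Equivalence)
open import Function.Construct.Composition using (_⇔-∘_)
open import Function.Construct.Symmetry using (⇔-sym)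
open import Relation.Binary.PropositionalEquality using (_≡_; refl; cong)

concatMap-map≡cartesianProductWith : ∀ {A B C : Set} (f : A → B → C) xs ys →
  concatMap (λ x → map (f x) ys) xs ≡ cartesianProductWith f xs ys
concatMap-map≡cartesianProductWith f []       ys = refl
concatMap-map≡cartesianProductWith f (x ∷ xs) ys =
  cong (map (f x) ys ++_) (concatMap-map≡cartesianProductWith f xs ys)

module _ {AP : Set} {S : LitSet AP} where

  ++-⊆S : (O₁ O₂ : Obligation AP) → (O₁ ++ O₂) ⊆S S ⇔ (O₁ ⊆S S × O₂ ⊆S S)
  ++-⊆S O₁ O₂ = mk⇔
    (λ s → (λ {e} m → s {e} (∈-++⁺ˡ m)) , (λ {e} m → s {e} (∈-++⁺ʳ O₁ m)))
    (λ (s₁ , s₂) {e} m → [ s₁ {e} , s₂ {e} ] (∈-++⁻ O₁ m))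

  []-⊆S : [] ⊆S S ⇔ ⊤
  []-⊆S = mk⇔ _ (λ _ {_} ())

  singleton-⊆S : (e : OElem AP) → (e ∷ []) ⊆S S ⇔ e ∈S S
  singleton-⊆S e = mk⇔ (λ s → s (here refl)) (λ { s {_} (here refl) → s })

  Discharged : List (Obligation AP) → Set
  Discharged Os = ∃ λ O → O ∈ Os × O ⊆S S

  discharged-singleton : (O : Obligation AP) → Discharged (O ∷ []) ⇔ O ⊆S S
  discharged-singleton O = mk⇔
    (λ { (_ , here refl , s) → s ; (_ , there () , _) })
    (λ s → O , here refl , s)

  discharged-++ : (Os₁ Os₂ : List (Obligation AP)) →
    Discharged (Os₁ ++ Os₂) ⇔ (Discharged Os₁ ⊎ Discharged Os₂)
  discharged-++ Os₁ Os₂ = mk⇔ split join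
    where
    split : Discharged (Os₁ ++ Os₂) → Discharged Os₁ ⊎ Discharged Os₂
    split (O , m , s) with ∈-++⁻ Os₁ m
    ... | inj₁ m₁ = inj₁ (O , m₁ , s)
    ... | inj₂ m₂ = inj₂ (O , m₂ , s)

    join : Discharged Os₁ ⊎ Discharged Os₂ → Discharged (Os₁ ++ Os₂)
    join (inj₁ (O , m , s)) = O , ∈-++⁺ˡ m , s
    join (inj₂ (O , m , s)) = O , ∈-++⁺ʳ Os₁ m , s

  discharged-cartesianProduct : (Os₁ Os₂ : List (Obligation AP)) →
    Discharged (cartesianProductWith _++_ Os₁ Os₂) ⇔ (Discharged Os₁ × Discharged Os₂)
  discharged-cartesianProduct Os₁ Os₂ = mk⇔ split join
    where
    split : Discharged (cartesianProductWith _++_ Os₁ Os₂) → Discharged Os₁ × Discharged Os₂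
    split (O , m , s) with ∈-cartesianProductWith⁻ _++_ Os₁ Os₂ m
    ... | O₁ , O₂ , m₁ , m₂ , refl with Equivalence.to (++-⊆S O₁ O₂) s
    ... | s₁ , s₂ = (O₁ , m₁ , s₁) , (O₂ , m₂ , s₂)

    join : Discharged Os₁ × Discharged Os₂ → Discharged (cartesianProductWith _++_ Os₁ Os₂)
    join ((O₁ , m₁ , s₁) , (O₂ , m₂ , s₂)) =
      O₁ ++ O₂ , ∈-cartesianProductWith⁺ _++_ m₁ m₂ , Equivalence.from (++-⊆S O₁ O₂) (s₁ , s₂)

lemma2 : {AP : Set} (φ : LTL AP) (S : LitSet AP) →
    (S ⊨w of φ) ⇔ (∃ λ O → (O ∈ olg φ) × (O ⊆S S))
lemma2 tt      S = ⇔-sym ([]-⊆S ⇔-∘ discharged-singleton [])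
lemma2 ff      S = ⇔-sym (singleton-⊆S ff ⇔-∘ discharged-singleton (ff ∷ []))
lemma2 (lit p) S = ⇔-sym (singleton-⊆S (lit p) ⇔-∘ discharged-singleton (lit p ∷ []))
lemma2 (φ ∧ ψ) S rewrite concatMap-map≡cartesianProductWith _++_ (olg φ) (olg ψ) =
  ⇔-sym (discharged-cartesianProduct (olg φ) (olg ψ)) ⇔-∘ (lemma2 φ S ×-⇔ lemma2 ψ S)
lemma2 (φ ∨ ψ) S = ⇔-sym (discharged-++ (olg φ) (olg ψ)) ⇔-∘ (lemma2 φ S ⊎-⇔ lemma2 ψ S)
lemma2 (X φ)   S = lemma2 φ S
lemma2 (φ U ψ) S = lemma2 ψ S
lemma2 (φ R ψ) S = lemma2 ψ S
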